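{- Let $s\ge 2$ and $t_1>t_2>\cdots>t_s\ge 2$ be integers, and let $K_{t_1,\dots,t_s}$ be the complete multipartite graph with parts $U_1,\dots,U_s$, $|U_i|=t_i$. Let $X\subseteq V$ contain exactly one vertex from each $U_i$, and let $K^{\sigma}_{t_1,\dots,t_s}$ be the switching about $X$. Then all eigenvalues of $K^{\sigma}_{t_1,\dots,t_s}$ are main.
   Context: A signed graph is a graph with edge signs $\pm1$; its adjacency matrix has entry equal to the sign of the edge for adjacent vertices and $0$ otherwise. The switching of a graph $G$ about $X\subseteq V(G)$ is the signed graph in which exactly the edges between $X$ and $V(G)\setminus X$ are negative. An eigenvalue is main if it has an eigenvector whose entries have nonzero sum. -}

module Defs where

open import Level using (Level; _⊔_) renaming (suc to lsuc)
open import Data.Nat using (ℕ; zero; suc; _≤_; _<_)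
open import Data.Fin using (Fin; _≟_)
import Data.Fin as Fin
open import Data.Product using (Σ; ∃; _,_; _×_)
open import Data.Bool using (Bool; true; false; if_then_else_; _xor_)
open import Relation.Nullary using (¬_; Dec; yes; no; does)
open import Relation.Binary.PropositionalEquality using (_≡_)
open import Algebra.Bundles using (CommutativeRing)
import Algebra.Definitions.RawMonoid as RM

record Char0Field (c ℓ : Level) : Set (lsuc (c ⊔ ℓ)) where
  field
    commRing : CommutativeRing c ℓ
  open CommutativeRing commRing public
  open RM +-rawMonoid using () renaming (_×_ to _·ₙ_) public
  field
    1≉0     : ¬ (1# ≈ 0#)
    inverse : ∀ x → ¬ (x ≈ 0#) → Σ Carrier (λ y → x * y ≈ 1#)
    char0   : ∀ n → (n ·ₙ 1#) ≈ 0# → n ≡ 0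

module _ {c ℓ : Level} (F : Char0Field c ℓ) where
  open Char0Field F
  open RM +-rawMonoid using (sum)

  Vertex : (s : ℕ) → (Fin s → ℕ) → Set
  Vertex s t = Σ (Fin s) (λ i → Fin (t i))

  vsum : (s : ℕ) (t : Fin s → ℕ) → (Vertex s t → Carrier) → Carrier
  vsum s t f = sum (λ i → sum (λ a → f (i , a)))

  inX : (s : ℕ) (t : Fin s → ℕ) (x : (i : Fin s) → Fin (t i)) → Vertex s t → Bool
  inX s t x (i , a) = does (a ≟ x i)

  switchedAdj : (s : ℕ) (t : Fin s → ℕ) (x : (i : Fin s) → Fin (t i)) →
                Vertex s t → Vertex s t → Carrier
  switchedAdj s t x (i , a) (j , b) with i ≟ j
  ... | yes _ = 0#
  ... | no _  = if (inX s t x (i , a) xor inX s t x (j , b)) then - 1# else 1#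

  mulVec : (s : ℕ) (t : Fin s → ℕ) → (Vertex s t → Vertex s t → Carrier) →
           (Vertex s t → Carrier) → Vertex s t → Carrier
  mulVec s t A v u = vsum s t (λ w → A u w * v w)

  -- v is an eigenvector of A for λ (possibly zero vector).
  IsEigenvec : (s : ℕ) (t : Fin s → ℕ) → (Vertex s t → Vertex s t → Carrier) →
               Carrier → (Vertex s t → Carrier) → Set ℓ
  IsEigenvec s t A λ′ v = ∀ u → mulVec s t A v u ≈ λ′ * v u

  IsEigenvalue : (s : ℕ) (t : Fin s → ℕ) → (Vertex s t → Vertex s t → Carrier) →
                 Carrier → Set (c ⊔ ℓ)
  IsEigenvalue s t A λ′ =
    Σ (Vertex s t → Carrier) (λ v → IsEigenvec s t A λ′ v × Σ (Vertex s t) (λ u → ¬ (v u ≈ 0#)))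

  IsMain : (s : ℕ) (t : Fin s → ℕ) → (Vertex s t → Vertex s t → Carrier) →
           Carrier → Set (c ⊔ ℓ)
  IsMain s t A λ′ =
    Σ (Vertex s t → Carrier) (λ v → IsEigenvec s t A λ′ v × ¬ (vsum s t v ≈ 0#))

module Submission where

-- Switching about X conjugates the adjacency matrix by the diagonal sign matrix D, so z ↦ D z turns
-- λ-eigenvectors of K^σ into λ-eigenvectors of the unsigned graph K_{t_1,…,t_s}, and the entry sum of D z
-- is that of z minus 2 ∑ᵢ z (i , xᵢ).
-- For λ ≠ 0 an eigenvector z of K is constant, cᵢ say, on each part U_i, with (λ + tᵢ) cᵢ = S := ∑ tⱼ cⱼ,
-- and D z has entry sum ∑ (tᵢ − 2) cᵢ = S − 2 ∑ cᵢ. If that sum vanished, then either ∑ cᵢ = 0, which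
-- forces λ = −t_k and c to live on the single part U_k (the tᵢ are distinct), or λ = 2s − 2 and
-- cᵢ = S / (2s − 2 + tᵢ) with S ≠ 0, whence ∑ (tᵢ − 2) / (2s − 2 + tᵢ) = 0, impossible as t_1 > 2.
-- For λ = 0 every part sum of z vanishes; moving a nonzero entry z (k , a) to x_k and replacing the
-- other parts by their means (here 0) gives an eigenvector whose switch has entry sum −2 z (k , a).
-- Equality in the field is not decidable, so this second vector is the witness in both cases.

open import Defs
open import Level using (Level)
open import Data.Nat as ℕ using (ℕ; _≤_; _<_; zero; suc; z≤n; s≤s)
import Data.Nat.Properties as ℕP
open import Data.Fin as Fin using (Fin; zero; suc; _≟_; punchIn)
import Data.Fin.Properties as FinP
open import Data.Fin.Permutation as Perm using (_⟨$⟩ʳ_)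
open import Data.Vec.Functional using (removeAt)
open import Data.Bool using (Bool; true; false; if_then_else_; _xor_)
open import Data.Bool.Properties using (xor-same)
open import Data.Product using (Σ; ∃₂; _,_; _×_; proj₁; proj₂)
open import Data.Sum using (inj₁; inj₂)
open import Function using (_∘_)
open import Function.Definitions using (Injective)
open import Relation.Nullary using (¬_; yes; no; does; contradiction)
open import Relation.Nullary.Decidable using (dec-true; dec-false)
open import Relation.Binary.Definitions using (tri<; tri≈; tri>)
open import Relation.Binary.PropositionalEquality using (_≡_; _≢_; cong)
  renaming (refl to ≡-refl; sym to ≡-sym; trans to trans′)

decreasing⇒injective : ∀ {s} {t : Fin s → ℕ} → (∀ i j → i Fin.< j → t j < t i) → Injective _≡_ _≡_ t
decreasing⇒injective decreasing {i} {j} tᵢ≡tⱼ with FinP.<-cmp i j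
... | tri< i<j _ _ = contradiction (decreasing i j i<j) (ℕP.<-irrefl (≡-sym tᵢ≡tⱼ))
... | tri≈ _ i≡j _ = i≡j
... | tri> _ _ j<i = contradiction (decreasing j i j<i) (ℕP.<-irrefl tᵢ≡tⱼ)

decreasing⇒first≥3 : ∀ {s} {t : Fin s → ℕ} → 2 ≤ s → (∀ i j → i Fin.< j → t j < t i) →
                      (∀ i → 2 ≤ t i) → Σ (Fin s) (λ i → 3 ≤ t i)
decreasing⇒first≥3 (s≤s (s≤s z≤n)) decreasing t≥2 =
  zero , ℕP.≤-trans (s≤s (t≥2 (suc zero))) (decreasing zero (suc zero) (s≤s z≤n))

transpose-matchˡ : ∀ {n} (i j : Fin n) → Perm.transpose i j ⟨$⟩ʳ i ≡ j
transpose-matchˡ i j rewrite dec-true (i ≟ i) ≡-refl = ≡-refl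

module _ {r ℓ : Level} (F : Char0Field r ℓ) where
  open Char0Field F hiding (zero)
  open import Algebra.Properties.Ring ring using (-1*x≈-x; -‿involutive; +-cancelˡ; +-cancelʳ)
  open import Algebra.Properties.Semiring.Mult semiring using (×-homo-+; ×1-homo-*; ×-assoc-*; ×-congʳ)
  open import Algebra.Properties.CommutativeMonoid.Mult +-commutativeMonoid using (×-distrib-+)
  open import Algebra.Properties.Semiring.Sum semiring
    using (sum; sum-cong-≋; sum-replicate; sum-replicate-zero; sum-remove; sum-permute; ∑-distrib-+; *-distribˡ-sum)
  open import Algebra.Solver.Ring.NaturalCoefficients.Default commutativeSemiring
    using (solve; _:+_; _:*_; _:=_)
  open import Relation.Binary.Reasoning.Setoid setoid

  fromℕ : ℕ → Carrier
  fromℕ n = n ·ₙ 1#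

  fromℕ-+ : ∀ m n → fromℕ (m ℕ.+ n) ≈ fromℕ m + fromℕ n
  fromℕ-+ = ×-homo-+ 1#

  fromℕ-* : ∀ m n → fromℕ (m ℕ.* n) ≈ fromℕ m * fromℕ n
  fromℕ-* = ×1-homo-*

  fromℕ*x≈n·x : ∀ n x → fromℕ n * x ≈ n ·ₙ x
  fromℕ*x≈n·x n x = trans (×-assoc-* n 1# x) (×-congʳ n (*-identityˡ x))

  *-cancelˡ-≉0 : ∀ x y z → ¬ x ≈ 0# → x * y ≈ x * z → y ≈ z
  *-cancelˡ-≉0 x y z x≉0 xy≈xz with inverse x x≉0
  ... | x⁻¹ , xx⁻¹≈1 = begin
    y               ≈⟨ *-identityˡ y ⟨
    1# * y          ≈⟨ *-congʳ x⁻¹x≈1 ⟨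
    (x⁻¹ * x) * y   ≈⟨ *-assoc x⁻¹ x y ⟩
    x⁻¹ * (x * y)   ≈⟨ *-congˡ xy≈xz ⟩
    x⁻¹ * (x * z)   ≈⟨ *-assoc x⁻¹ x z ⟨
    (x⁻¹ * x) * z   ≈⟨ *-congʳ x⁻¹x≈1 ⟩
    1# * z          ≈⟨ *-identityˡ z ⟩
    z               ∎
    where x⁻¹x≈1 = trans (*-comm x⁻¹ x) xx⁻¹≈1

  x*y≈0⇒y≈0 : ∀ {x y} → ¬ x ≈ 0# → x * y ≈ 0# → y ≈ 0#
  x*y≈0⇒y≈0 {x} {y} x≉0 xy≈0 = *-cancelˡ-≉0 x y 0# x≉0 (trans xy≈0 (sym (zeroʳ x)))

  fromℕ≉0 : ∀ {n} → n ≢ 0 → ¬ fromℕ n ≈ 0#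
  fromℕ≉0 {n} n≢0 = n≢0 ∘ char0 n

  n·x≈0⇒x≈0 : ∀ {n x} → n ≢ 0 → n ·ₙ x ≈ 0# → x ≈ 0#
  n·x≈0⇒x≈0 {n} {x} n≢0 nx≈0 = x*y≈0⇒y≈0 (fromℕ≉0 n≢0) (trans (fromℕ*x≈n·x n x) nx≈0)

  x+x≈0⇒x≈0 : ∀ {x} → x + x ≈ 0# → x ≈ 0#
  x+x≈0⇒x≈0 {x} x+x≈0 = n·x≈0⇒x≈0 {2} (λ ()) (trans (+-congˡ (+-identityʳ x)) x+x≈0)

  x≈n·x⇒x≈0 : ∀ {n x} → 2 ≤ n → x ≈ n ·ₙ x → x ≈ 0#
  x≈n·x⇒x≈0 {suc (suc n)} {x} (s≤s (s≤s z≤n)) x≈nx =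
    n·x≈0⇒x≈0 {suc n} (λ ()) (sym (+-cancelˡ x 0# _ (trans (+-identityʳ x) x≈nx)))

  fromℕ-injective-≤ : ∀ {m n} → m ≤ n → fromℕ m ≈ fromℕ n → m ≡ n
  fromℕ-injective-≤ {m} m≤n m≈n with ℕP.m≤n⇒∃[o]m+o≡n m≤n
  ... | o , ≡-refl = ≡-sym (trans′ (cong (m ℕ.+_) (char0 o o≈0)) (ℕP.+-identityʳ m))
    where
    o≈0 : fromℕ o ≈ 0#
    o≈0 = +-cancelˡ (fromℕ m) _ _ (trans (sym (fromℕ-+ m o)) (trans (sym m≈n) (sym (+-identityʳ _))))

  fromℕ-injective : ∀ {m n} → fromℕ m ≈ fromℕ n → m ≡ n
  fromℕ-injective {m} {n} m≈n with ℕP.≤-total m n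
  ... | inj₁ m≤n = fromℕ-injective-≤ m≤n m≈n
  ... | inj₂ n≤m = ≡-sym (fromℕ-injective-≤ n≤m (sym m≈n))

  sign : Bool → Carrier
  sign b = if b then - 1# else 1#

  sign-xor : ∀ p q → sign (p xor q) ≈ sign p * sign q
  sign-xor true  true  = sym (trans (-1*x≈-x (- 1#)) (-‿involutive 1#))
  sign-xor true  false = sym (*-identityʳ (- 1#))
  sign-xor false q     = sym (*-identityˡ (sign q))

  sign*sign≈1 : ∀ p → sign p * sign p ≈ 1#
  sign*sign≈1 p = trans (sym (sign-xor p p)) (reflexive (cong sign (xor-same p)))

  sum-single : ∀ {n} (g : Fin n → Carrier) j → (∀ i → i ≢ j → g i ≈ 0#) → sum g ≈ g j
  sum-single {suc n} g j g≈0 = begin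
    sum g                     ≈⟨ sum-remove {i = j} g ⟩
    g j + sum (removeAt g j)  ≈⟨ +-congˡ (trans (sum-cong-≋ (λ i → g≈0 _ (FinP.punchInᵢ≢i j i)))
                                                (sum-replicate-zero n)) ⟩
    g j + 0#                  ≈⟨ +-identityʳ (g j) ⟩
    g j                       ∎

  ∑-punctured : ∀ {n} → (Fin n → Carrier) → Fin n → Carrier
  ∑-punctured g j = sum (λ i → if does (j ≟ i) then 0# else g i)

  ∑-punctured-+ : ∀ {n} (g : Fin n → Carrier) j → ∑-punctured g j + g j ≈ sum g
  ∑-punctured-+ g zero = trans (+-comm _ (g zero)) (+-congˡ (+-identityˡ _))
  ∑-punctured-+ g (suc j) =
    trans (+-assoc (g zero) _ _) (+-congˡ (∑-punctured-+ (g ∘ suc) j))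

  ∑-punctured-cong : ∀ {n} {f g : Fin n → Carrier} → (∀ i → f i ≈ g i) →
                     ∀ j → ∑-punctured f j ≈ ∑-punctured g j
  ∑-punctured-cong {f = f} {g} f≈g j = sum-cong-≋ pointwise
    where
    pointwise : ∀ i → (if does (j ≟ i) then 0# else f i) ≈ (if does (j ≟ i) then 0# else g i)
    pointwise i with does (j ≟ i)
    ... | true  = refl
    ... | false = f≈g i

  ∑-flip-at : ∀ {n} (p : Fin n) (f : Fin n → Carrier) →
              sum (λ b → sign (does (b ≟ p)) * f b) + (f p + f p) ≈ sum f
  ∑-flip-at {suc n} p f = begin
    sum flipped + (f p + f p)                            ≈⟨ +-congʳ (sum-remove {i = p} flipped) ⟩
    (flipped p + sum (removeAt flipped p)) + (f p + f p) ≈⟨ +-congʳ (+-cong flipped-p (sum-cong-≋ flipped-off-p)) ⟩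
    (- f p + sum (removeAt f p)) + (f p + f p)
      ≈⟨ solve 3 (λ a -a r → (-a :+ r) :+ (a :+ a) := (-a :+ a) :+ (a :+ r)) refl (f p) (- f p) _ ⟩
    (- f p + f p) + (f p + sum (removeAt f p))           ≈⟨ trans (+-congʳ (-‿inverseˡ (f p))) (+-identityˡ _) ⟩
    f p + sum (removeAt f p)                             ≈⟨ sum-remove {i = p} f ⟨
    sum f                                                ∎
    where
    flipped : Fin (suc n) → Carrier
    flipped b = sign (does (b ≟ p)) * f b
    flipped-p : flipped p ≈ - f p
    flipped-p = trans (reflexive (cong (λ d → sign d * f p) (dec-true (p ≟ p) ≡-refl))) (-1*x≈-x (f p))
    flipped-off-p : ∀ i → flipped (punchIn p i) ≈ f (punchIn p i)
    flipped-off-p i = trans (reflexive (cong (λ d → sign d * f (punchIn p i)) (dec-false (_ ≟ p) (FinP.punchInᵢ≢i p i))))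
                            (*-identityˡ _)

  -- If c i = τ / m i, multiplying ∑ ν i · c i by M = ∏ m i leaves N · τ with N = ∑ ν i ∏_{j ≠ i} m j.
  clear-denominators : ∀ {n} (m ν : Fin n → ℕ) (c : Fin n → Carrier) τ →
    (∀ i → 1 ≤ m i) → (∀ i → fromℕ (m i) * c i ≈ τ) →
    ∃₂ λ M N → 1 ≤ M × (∀ i → ν i ≤ N) × fromℕ M * sum (λ i → fromℕ (ν i) * c i) ≈ fromℕ N * τ
  clear-denominators {zero} m ν c τ _ _ = 1 , 0 , ℕP.≤-refl , (λ ()) , trans (zeroʳ _) (sym (zeroˡ τ))
  clear-denominators {suc n} m ν c τ m≥1 mc≈τ
    with M , N , M≥1 , ν≤N , MΣ≈Nτ ←
           clear-denominators (m ∘ suc) (ν ∘ suc) (c ∘ suc) τ (m≥1 ∘ suc) (mc≈τ ∘ suc)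
    = m₀ ℕ.* M , ν₀ ℕ.* M ℕ.+ m₀ ℕ.* N , ℕP.*-mono-≤ (m≥1 zero) M≥1 , dominated , cleared
    where
    m₀ ν₀ : ℕ
    m₀ = m zero
    ν₀ = ν zero
    Σ′ : Carrier
    Σ′ = sum (λ i → fromℕ (ν (suc i)) * c (suc i))
    dominated : ∀ i → ν i ≤ ν₀ ℕ.* M ℕ.+ m₀ ℕ.* N
    dominated zero    = ℕP.≤-trans (ℕP.≤-reflexive (≡-sym (ℕP.*-identityʳ ν₀)))
                                   (ℕP.≤-trans (ℕP.*-monoʳ-≤ ν₀ M≥1) (ℕP.m≤m+n _ _))
    dominated (suc i) = ℕP.≤-trans (ν≤N i)
                          (ℕP.≤-trans (ℕP.≤-reflexive (≡-sym (ℕP.*-identityˡ N)))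
                            (ℕP.≤-trans (ℕP.*-monoˡ-≤ N (m≥1 zero)) (ℕP.m≤n+m _ _)))
    cleared : fromℕ (m₀ ℕ.* M) * (fromℕ ν₀ * c zero + Σ′) ≈ fromℕ (ν₀ ℕ.* M ℕ.+ m₀ ℕ.* N) * τ
    cleared = begin
      fromℕ (m₀ ℕ.* M) * (fromℕ ν₀ * c zero + Σ′)
        ≈⟨ *-congʳ (fromℕ-* m₀ M) ⟩
      (fromℕ m₀ * fromℕ M) * (fromℕ ν₀ * c zero + Σ′)
        ≈⟨ solve 5 (λ a b d e f → (a :* b) :* (d :* e :+ f) := b :* d :* (a :* e) :+ a :* (b :* f)) refl
                 (fromℕ m₀) (fromℕ M) (fromℕ ν₀) (c zero) Σ′ ⟩
      fromℕ M * fromℕ ν₀ * (fromℕ m₀ * c zero) + fromℕ m₀ * (fromℕ M * Σ′)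
        ≈⟨ +-cong (*-congˡ (mc≈τ zero)) (*-congˡ MΣ≈Nτ) ⟩
      fromℕ M * fromℕ ν₀ * τ + fromℕ m₀ * (fromℕ N * τ)
        ≈⟨ solve 5 (λ a b d e f → b :* d :* f :+ a :* (e :* f) := (d :* b :+ a :* e) :* f) refl
                 (fromℕ m₀) (fromℕ M) (fromℕ ν₀) (fromℕ N) τ ⟩
      (fromℕ ν₀ * fromℕ M + fromℕ m₀ * fromℕ N) * τ
        ≈⟨ *-congʳ (sym (trans (fromℕ-+ (ν₀ ℕ.* M) (m₀ ℕ.* N)) (+-cong (fromℕ-* ν₀ M) (fromℕ-* m₀ N)))) ⟩
      fromℕ (ν₀ ℕ.* M ℕ.+ m₀ ℕ.* N) * τ
        ∎

  x+x≈2*x : ∀ x → x + x ≈ fromℕ 2 * x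
  x+x≈2*x x = sym (trans (fromℕ*x≈n·x 2 x) (+-congˡ (+-identityʳ x)))

  *-cancelʳ-≉0 : ∀ x y z → ¬ x ≈ 0# → y * x ≈ z * x → y ≈ z
  *-cancelʳ-≉0 x y z x≉0 yx≈zx = *-cancelˡ-≉0 x y z x≉0 (trans (*-comm x y) (trans yx≈zx (*-comm z x)))

  -- c is a λ′-eigenvector of the quotient matrix of K_{t_1,…,t_s} (entry t j off the diagonal),
  -- and ∑ (t i − 2) c i = 0.
  module QuotientEigenvector {s : ℕ} (t : Fin s → ℕ) (λ′ : Carrier) (c : Fin s → Carrier)
    (balance : ∀ i → λ′ * c i + fromℕ (t i) * c i ≈ sum (λ j → fromℕ (t j) * c j))
    (nonmain : sum (λ j → fromℕ (t j) * c j) ≈ sum c + sum c) where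

    S T : Carrier
    S = sum (λ j → fromℕ (t j) * c j)
    T = sum c

    total-≈0 : Injective _≡_ _≡_ t → T ≈ 0# → ∀ k → ¬ ¬ c k ≈ 0#
    total-≈0 t-injective T≈0 k cₖ≉0 = cₖ≉0 (trans (sym (sum-single c k others)) T≈0)
      where
      root : ∀ i → (λ′ + fromℕ (t i)) * c i ≈ 0#
      root i = trans (distribʳ (c i) λ′ (fromℕ (t i)))
                     (trans (balance i) (trans nonmain (trans (+-cong T≈0 T≈0) (+-identityʳ 0#))))
      rootₖ : λ′ + fromℕ (t k) ≈ 0#
      rootₖ = x*y≈0⇒y≈0 cₖ≉0 (trans (*-comm (c k) _) (root k))
      others : ∀ i → i ≢ k → c i ≈ 0#
      others i i≢k = x*y≈0⇒y≈0 not-root (root i)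
        where
        not-root : ¬ λ′ + fromℕ (t i) ≈ 0#
        not-root rootᵢ = i≢k (t-injective (fromℕ-injective (+-cancelˡ λ′ _ _ (trans rootᵢ (sym rootₖ)))))

    eigenvalue : ¬ T ≈ 0# → λ′ + fromℕ 2 ≈ fromℕ (s ℕ.+ s)
    eigenvalue T≉0 = *-cancelʳ-≉0 T _ _ T≉0 (begin
      (λ′ + fromℕ 2) * T              ≈⟨ trans (distribʳ T λ′ (fromℕ 2)) (+-congˡ (sym (x+x≈2*x T))) ⟩
      λ′ * T + (T + T)                ≈⟨ +-cong (*-distribˡ-sum λ′ c) (sym nonmain) ⟩
      sum (λ i → λ′ * c i) + S        ≈⟨ ∑-distrib-+ (λ i → λ′ * c i) (λ i → fromℕ (t i) * c i) ⟨
      sum (λ i → λ′ * c i + fromℕ (t i) * c i) ≈⟨ trans (sum-cong-≋ balance) (sum-replicate s) ⟩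
      s ·ₙ S                          ≈⟨ trans (×-congʳ s nonmain) (×-distrib-+ T T s) ⟩
      s ·ₙ T + s ·ₙ T                 ≈⟨ ×-homo-+ T s s ⟨
      (s ℕ.+ s) ·ₙ T                  ≈⟨ fromℕ*x≈n·x (s ℕ.+ s) T ⟨
      fromℕ (s ℕ.+ s) * T             ∎)

    excess : Fin s → ℕ
    excess i = t i ℕ.∸ 2

    module _ (t≥2 : ∀ i → 2 ≤ t i) where

      fromℕ-t : ∀ i → fromℕ (t i) ≈ fromℕ (excess i) + fromℕ 2
      fromℕ-t i = trans (reflexive (cong fromℕ (≡-sym (ℕP.m∸n+n≡m (t≥2 i))))) (fromℕ-+ (excess i) 2)

      ∑-excess≈0 : sum (λ i → fromℕ (excess i) * c i) ≈ 0#
      ∑-excess≈0 = +-cancelʳ (T + T) _ 0# (begin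
        sum (λ i → fromℕ (excess i) * c i) + (T + T)   ≈⟨ +-congˡ (∑-distrib-+ c c) ⟨
        sum (λ i → fromℕ (excess i) * c i) + sum (λ i → c i + c i)
                                                        ≈⟨ ∑-distrib-+ _ (λ i → c i + c i) ⟨
        sum (λ i → fromℕ (excess i) * c i + (c i + c i)) ≈⟨ sum-cong-≋ excess+2 ⟩
        S                                              ≈⟨ trans nonmain (sym (+-identityˡ _)) ⟩
        0# + (T + T)                                   ∎)
        where
        excess+2 : ∀ i → fromℕ (excess i) * c i + (c i + c i) ≈ fromℕ (t i) * c i
        excess+2 i = trans (+-congˡ (x+x≈2*x (c i)))
                           (trans (sym (distribʳ (c i) _ _)) (*-congʳ (sym (fromℕ-t i))))

      total-≉0 : (i₀ : Fin s) → 3 ≤ t i₀ → ¬ ¬ T ≈ 0#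
      total-≉0 i₀ tᵢ₀≥3 T≉0 = T≉0 (x+x≈0⇒x≈0 (trans (sym nonmain) S≈0))
        where
        m : Fin s → ℕ
        m i = (s ℕ.+ s) ℕ.+ excess i
        m≥1 : ∀ i → 1 ≤ m i
        m≥1 i = ℕP.≤-trans (ℕP.≤-trans (s≤s z≤n) (FinP.toℕ<n i)) (ℕP.≤-trans (ℕP.m≤m+n s s) (ℕP.m≤m+n _ _))
        mc≈S : ∀ i → fromℕ (m i) * c i ≈ S
        mc≈S i = begin
          fromℕ (m i) * c i                     ≈⟨ *-congʳ (fromℕ-+ (s ℕ.+ s) (excess i)) ⟩
          (fromℕ (s ℕ.+ s) + fromℕ (excess i)) * c i ≈⟨ *-congʳ (+-congʳ (sym (eigenvalue T≉0))) ⟩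
          ((λ′ + fromℕ 2) + fromℕ (excess i)) * c i
            ≈⟨ *-congʳ (solve 3 (λ a b d → (a :+ b) :+ d := a :+ (d :+ b)) refl λ′ (fromℕ 2) (fromℕ (excess i))) ⟩
          (λ′ + (fromℕ (excess i) + fromℕ 2)) * c i ≈⟨ *-congʳ (+-congˡ (sym (fromℕ-t i))) ⟩
          (λ′ + fromℕ (t i)) * c i              ≈⟨ distribʳ (c i) λ′ (fromℕ (t i)) ⟩
          λ′ * c i + fromℕ (t i) * c i          ≈⟨ balance i ⟩
          S                                     ∎
        S≈0 : S ≈ 0#
        S≈0 with M , N , _ , excess≤N , MΣ≈NS ← clear-denominators m excess c S m≥1 mc≈S =
          x*y≈0⇒y≈0 (fromℕ≉0 N≢0) (trans (sym MΣ≈NS) (trans (*-congˡ ∑-excess≈0) (zeroʳ _)))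
          where
          N≢0 : N ≢ 0
          N≢0 = ℕP.n>0⇒n≢0 (ℕP.≤-trans (ℕP.∸-monoˡ-≤ 2 tᵢ₀≥3) (excess≤N i₀))

    vanishes : Injective _≡_ _≡_ t → (∀ i → 2 ≤ t i) → (i₀ : Fin s) → 3 ≤ t i₀ → ∀ k → ¬ ¬ c k ≈ 0#
    vanishes t-injective t≥2 i₀ tᵢ₀≥3 k cₖ≉0 =
      total-≉0 t≥2 i₀ tᵢ₀≥3 (λ T≈0 → total-≈0 t-injective T≈0 k cₖ≉0)

  module Switching {s : ℕ} {t : Fin s → ℕ} (x : (i : Fin s) → Fin (t i)) where

    V : Set
    V = Vertex F s t

    A : V → V → Carrier
    A = switchedAdj F s t x

    σ : V → Carrier
    σ u = sign (inX F s t x u)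

    σ*[σ*r]≈r : ∀ u r → σ u * (σ u * r) ≈ r
    σ*[σ*r]≈r u r = trans (sym (*-assoc _ _ r)) (trans (*-congʳ (sign*sign≈1 _)) (*-identityˡ r))

    σ*[r*q]≈r*[σ*q] : ∀ u r q → σ u * (r * q) ≈ r * (σ u * q)
    σ*[r*q]≈r*[σ*q] u r q = solve 3 (λ a b d → a :* (b :* d) := b :* (a :* d)) refl (σ u) r q

    switch : (V → Carrier) → V → Carrier
    switch z u = σ u * z u

    switch-involutive : ∀ z u → switch (switch z) u ≈ z u
    switch-involutive z u = σ*[σ*r]≈r u (z u)

    switch-≉0 : ∀ z u → ¬ z u ≈ 0# → ¬ switch z u ≈ 0#
    switch-≉0 z u zᵤ≉0 σzᵤ≈0 = zᵤ≉0 (trans (sym (switch-involutive z u)) (trans (*-congˡ σzᵤ≈0) (zeroʳ _)))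

    partSum : (V → Carrier) → Fin s → Carrier
    partSum z i = sum (λ a → z (i , a))

    -- y is a λ′-eigenvector of the unsigned graph K_{t_1,…,t_s}, whose row (j , b) sums the other parts.
    IsUnsignedEigenvec : Carrier → (V → Carrier) → Set ℓ
    IsUnsignedEigenvec λ′ y = ∀ j b → ∑-punctured (partSum y) j ≈ λ′ * y (j , b)

    switchedAdj-row : ∀ z j b i → sum (λ a → A (j , b) (i , a) * z (i , a))
                                  ≈ σ (j , b) * (if does (j ≟ i) then 0# else partSum (switch z) i)
    switchedAdj-row z j b i with j ≟ i
    ... | yes _ = trans (sym (*-distribˡ-sum 0# (λ a → z (i , a)))) (trans (zeroˡ _) (sym (zeroʳ _)))
    ... | no _  = trans (sum-cong-≋ (λ a → trans (*-congʳ (sign-xor (inX F s t x (j , b)) (inX F s t x (i , a))))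
                                                  (*-assoc _ _ _)))
                        (sym (*-distribˡ-sum (σ (j , b)) (λ a → switch z (i , a))))

    mulVec-switchedAdj : ∀ z j b → mulVec F s t A z (j , b) ≈ σ (j , b) * ∑-punctured (partSum (switch z)) j
    mulVec-switchedAdj z j b = trans (sum-cong-≋ (switchedAdj-row z j b))
                                     (sym (*-distribˡ-sum (σ (j , b)) (λ i → if does (j ≟ i) then 0# else partSum (switch z) i)))

    switch-eigenvec⁻ : ∀ {λ′ z} → IsEigenvec F s t A λ′ z → IsUnsignedEigenvec λ′ (switch z)
    switch-eigenvec⁻ {λ′} {z} eig j b = begin
      ∑-punctured (partSum (switch z)) j              ≈⟨ σ*[σ*r]≈r (j , b) _ ⟨
      σ (j , b) * (σ (j , b) * ∑-punctured (partSum (switch z)) j)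
                                                      ≈⟨ *-congˡ (trans (sym (mulVec-switchedAdj z j b)) (eig (j , b))) ⟩
      σ (j , b) * (λ′ * z (j , b))                    ≈⟨ σ*[r*q]≈r*[σ*q] (j , b) λ′ _ ⟩
      λ′ * switch z (j , b)                           ∎

    switch-eigenvec⁺ : ∀ {λ′ y} → IsUnsignedEigenvec λ′ y → IsEigenvec F s t A λ′ (switch y)
    switch-eigenvec⁺ {λ′} {y} eig (j , b) = begin
      mulVec F s t A (switch y) (j , b)                   ≈⟨ mulVec-switchedAdj (switch y) j b ⟩
      σ (j , b) * ∑-punctured (partSum (switch (switch y))) j
        ≈⟨ *-congˡ (∑-punctured-cong (λ i → sum-cong-≋ (λ a → switch-involutive y (i , a))) j) ⟩
      σ (j , b) * ∑-punctured (partSum y) j               ≈⟨ *-congˡ (eig j b) ⟩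
      σ (j , b) * (λ′ * y (j , b))                        ≈⟨ σ*[r*q]≈r*[σ*q] (j , b) λ′ _ ⟩
      λ′ * switch y (j , b)                               ∎

    vsum-switch : ∀ y → vsum F s t (switch y) + (sum (λ i → y (i , x i)) + sum (λ i → y (i , x i)))
                        ≈ vsum F s t y
    vsum-switch y = begin
      vsum F s t (switch y) + (sum d + sum d)       ≈⟨ +-congˡ (∑-distrib-+ d d) ⟨
      vsum F s t (switch y) + sum (λ i → d i + d i) ≈⟨ ∑-distrib-+ (partSum (switch y)) _ ⟨
      sum (λ i → partSum (switch y) i + (d i + d i)) ≈⟨ sum-cong-≋ (λ i → ∑-flip-at (x i) (λ a → y (i , a))) ⟩
      vsum F s t y                                  ∎
      where
      d : Fin s → Carrier
      d i = y (i , x i)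

    nonzero-eigenvalue-main : Injective _≡_ _≡_ t → (∀ i → 2 ≤ t i) → (i₀ : Fin s) → 3 ≤ t i₀ →
      ∀ {λ′ y} → IsUnsignedEigenvec λ′ y → ¬ λ′ ≈ 0# → vsum F s t (switch y) ≈ 0# → ∀ u → ¬ ¬ y u ≈ 0#
    nonzero-eigenvalue-main t-injective t≥2 i₀ tᵢ₀≥3 {λ′} {y} eig λ′≉0 ∑≈0 (k , b) yₖ≉0 =
      QuotientEigenvector.vanishes t λ′ c balance nonmain t-injective t≥2 i₀ tᵢ₀≥3 k
        (λ cₖ≈0 → yₖ≉0 (trans (constant k b) cₖ≈0))
      where
      c : Fin s → Carrier
      c j = y (j , x j)
      constant : ∀ j b → y (j , b) ≈ c j
      constant j b = *-cancelˡ-≉0 λ′ _ _ λ′≉0 (trans (sym (eig j b)) (eig j (x j)))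
      partSum≈ : ∀ j → partSum y j ≈ fromℕ (t j) * c j
      partSum≈ j = trans (sum-cong-≋ (constant j)) (trans (sum-replicate (t j)) (sym (fromℕ*x≈n·x (t j) (c j))))
      balance : ∀ j → λ′ * c j + fromℕ (t j) * c j ≈ sum (λ i → fromℕ (t i) * c i)
      balance j = trans (+-cong (sym (eig j (x j))) (sym (partSum≈ j)))
                        (trans (∑-punctured-+ (partSum y) j) (sum-cong-≋ partSum≈))
      nonmain : sum (λ i → fromℕ (t i) * c i) ≈ sum c + sum c
      nonmain = trans (sym (sum-cong-≋ partSum≈))
                      (trans (sym (vsum-switch y)) (trans (+-congʳ ∑≈0) (+-identityˡ _)))

    -- ȳ keeps the part sums of y, so it is again an eigenvector; at λ′ = 0 the means vanish and
    -- the entries of ȳ on X add up to y (k , a).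
    module Averaged {λ′ : Carrier} {y : V → Carrier} (eig : IsUnsignedEigenvec λ′ y)
                    (t≢0 : ∀ i → t i ≢ 0) (k : Fin s) (a : Fin (t k)) where

      t⁻¹ : Fin s → Carrier
      t⁻¹ i = proj₁ (inverse (fromℕ (t i)) (fromℕ≉0 (t≢0 i)))

      t*t⁻¹≈1 : ∀ i → fromℕ (t i) * t⁻¹ i ≈ 1#
      t*t⁻¹≈1 i = proj₂ (inverse (fromℕ (t i)) (fromℕ≉0 (t≢0 i)))

      t*[r*t⁻¹]≈r : ∀ i r → fromℕ (t i) * (r * t⁻¹ i) ≈ r
      t*[r*t⁻¹]≈r i r = trans (solve 3 (λ a b d → a :* (b :* d) := b :* (a :* d)) refl (fromℕ (t i)) r (t⁻¹ i))
                             (trans (*-congˡ (t*t⁻¹≈1 i)) (*-identityʳ r))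

      mean : Fin s → Carrier
      mean i = partSum y i * t⁻¹ i

      λ′*mean : ∀ i → λ′ * mean i ≈ ∑-punctured (partSum y) i
      λ′*mean i = begin
        λ′ * (partSum y i * t⁻¹ i)        ≈⟨ *-assoc λ′ _ _ ⟨
        (λ′ * partSum y i) * t⁻¹ i        ≈⟨ *-congʳ (*-distribˡ-sum λ′ (λ b → y (i , b))) ⟩
        sum (λ b → λ′ * y (i , b)) * t⁻¹ i ≈⟨ *-congʳ (sum-cong-≋ (λ b → sym (eig i b))) ⟩
        sum {t i} (λ _ → R) * t⁻¹ i       ≈⟨ *-congʳ (trans (sum-replicate (t i)) (sym (fromℕ*x≈n·x (t i) R))) ⟩
        (fromℕ (t i) * R) * t⁻¹ i         ≈⟨ *-assoc _ R _ ⟩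
        fromℕ (t i) * (R * t⁻¹ i)         ≈⟨ t*[r*t⁻¹]≈r i R ⟩
        R                                 ∎
        where R = ∑-punctured (partSum y) i

      ȳ : V → Carrier
      ȳ (i , b) with i ≟ k
      ... | yes ≡-refl = y (k , Perm.transpose (x k) a ⟨$⟩ʳ b)
      ... | no _       = mean i

      ȳ-off : ∀ {i} b → i ≢ k → ȳ (i , b) ≈ mean i
      ȳ-off {i} b i≢k with i ≟ k
      ... | yes i≡k = contradiction i≡k i≢k
      ... | no _    = refl

      ȳ-at-x : ȳ (k , x k) ≈ y (k , a)
      ȳ-at-x with k ≟ k
      ... | yes ≡-refl = reflexive (cong (λ b → y (k , b)) (transpose-matchˡ (x k) a))
      ... | no k≢k     = contradiction ≡-refl k≢k

      partSum-ȳ : ∀ i → partSum ȳ i ≈ partSum y i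
      partSum-ȳ i with i ≟ k
      ... | yes ≡-refl = sym (sum-permute (λ b → y (k , b)) (Perm.transpose (x k) a))
      ... | no _       = trans (sum-replicate (t i)) (trans (sym (fromℕ*x≈n·x (t i) (mean i))) (t*[r*t⁻¹]≈r i _))

      ȳ-eigenvec : IsUnsignedEigenvec λ′ ȳ
      ȳ-eigenvec j b = trans (∑-punctured-cong partSum-ȳ j) (λ′*ȳ j b)
        where
        λ′*ȳ : ∀ j b → ∑-punctured (partSum y) j ≈ λ′ * ȳ (j , b)
        λ′*ȳ j b with j ≟ k
        ... | yes ≡-refl = eig k _
        ... | no _       = sym (λ′*mean j)

      zero-eigenvalue-main : 2 ≤ s → λ′ ≈ 0# → ¬ y (k , a) ≈ 0# → ¬ vsum F s t (switch ȳ) ≈ 0#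
      zero-eigenvalue-main 2≤s λ′≈0 yₖₐ≉0 ∑≈0 = yₖₐ≉0 (x+x≈0⇒x≈0 (begin
        y (k , a) + y (k , a)     ≈⟨ +-cong ∑ȳx≈yₖₐ ∑ȳx≈yₖₐ ⟨
        sum ȳx + sum ȳx           ≈⟨ +-identityˡ _ ⟨
        0# + (sum ȳx + sum ȳx)    ≈⟨ +-congʳ ∑≈0 ⟨
        vsum F s t (switch ȳ) + (sum ȳx + sum ȳx) ≈⟨ vsum-switch ȳ ⟩
        vsum F s t ȳ              ≈⟨ sum-cong-≋ (λ i → trans (partSum-ȳ i) (partSum≈0 i)) ⟩
        sum {s} (λ _ → 0#)        ≈⟨ sum-replicate-zero s ⟩
        0#                        ∎))
        where
        partSum≈vsum : ∀ j → partSum y j ≈ vsum F s t y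
        partSum≈vsum j = trans (sym (+-identityˡ _))
          (trans (+-congʳ (sym (trans (eig j (x j)) (trans (*-congʳ λ′≈0) (zeroˡ _)))))
                 (∑-punctured-+ (partSum y) j))
        vsum≈0 : vsum F s t y ≈ 0#
        vsum≈0 = x≈n·x⇒x≈0 2≤s (trans (sum-cong-≋ partSum≈vsum) (sum-replicate s))
        partSum≈0 : ∀ j → partSum y j ≈ 0#
        partSum≈0 j = trans (partSum≈vsum j) vsum≈0
        ȳx : Fin s → Carrier
        ȳx i = ȳ (i , x i)
        ∑ȳx≈yₖₐ : sum ȳx ≈ y (k , a)
        ∑ȳx≈yₖₐ = trans (sum-single ȳx k (λ i i≢k → trans (ȳ-off (x i) i≢k)
                                                        (trans (*-congʳ (partSum≈0 i)) (zeroˡ _))))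
                        ȳ-at-x


proposition4p1 : {c ℓ : Level} (F : Char0Field c ℓ) →
    (s : ℕ) → 2 ≤ s →
    (t : Fin s → ℕ) →
    (∀ i j → i Fin.< j → t j < t i) →
    (∀ i → 2 ≤ t i) →
    (x : (i : Fin s) → Fin (t i)) →
    (λ′ : Char0Field.Carrier F) →
    IsEigenvalue F s t (switchedAdj F s t x) λ′ →
    IsMain F s t (switchedAdj F s t x) λ′
proposition4p1 F s 2≤s t decreasing t≥2 x λ′ (v , eig , (k , a) , vₖₐ≉0) =
  switch ȳ , switch-eigenvec⁺ ȳ-eigenvec , λ ∑≈0 →
    nonzero-eigenvalue-main (decreasing⇒injective decreasing) t≥2 i₀ tᵢ₀≥3 ȳ-eigenvec
      (λ λ′≈0 → zero-eigenvalue-main 2≤s λ′≈0 yₖₐ≉0 ∑≈0) ∑≈0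
      (k , x k) (λ ȳₖₓ≈0 → yₖₐ≉0 (trans (sym ȳ-at-x) ȳₖₓ≈0))
  where
  open Char0Field F using (_≈_; 0#; trans; sym)
  open Switching F x
  open Averaged (switch-eigenvec⁻ eig) (λ i → ℕP.m<n⇒n≢0 (t≥2 i)) k a
  yₖₐ≉0 : ¬ switch v (k , a) ≈ 0#
  yₖₐ≉0 = switch-≉0 v (k , a) vₖₐ≉0
  i₀ : Fin s
  i₀ = proj₁ (decreasing⇒first≥3 2≤s decreasing t≥2)
  tᵢ₀≥3 : 3 ≤ t i₀
  tᵢ₀≥3 = proj₂ (decreasing⇒first≥3 2≤s decreasing t≥2)
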